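{- Fix $k \ge 2$, $n \ge 1$, and $D_k \in \mathcal{D}_k$. Let $X_1,\dots,X_k$ be disjoint sets each of size $n$, and let $J_k$ be the $(k+1)$-uniform hypergraph with vertex set $X_1\times\cdots\times X_k$ whose edges are the sets $A \subseteq X_1\times\cdots\times X_k$ that, viewed as the edge set of a $k$-partite $k$-uniform hypergraph with parts $X_1,\dots,X_k$, are isomorphic to $D_k$. Then $J_k$ has $n^k$ vertices, $\alpha(J_k) \le kn^{k-1}$, and $J_k$ is $2^{2k^2-2k-1}$-sparse.
   Context: The family $\mathcal{D}_k$ of special $k$-clusters is defined inductively: $\mathcal{D}_2 = \{D_2\}$ where $D_2$ is the graph path with three edges. For $k \ge 3$, $\mathcal{D}_k$ consists of all $k$-uniform hypergraphs obtained by taking any $D_{k-1} \in \mathcal{D}_{k-1}$ (which has $2(k-1)$ vertices and two disjoint edges $a,b$), adding two new vertices $x,y$, enlarging every edge of $D_{k-1}$ by $x$, and adding the edge $a\cup\{y\}$; members of $\mathcal{D}_k$ have $2k$ vertices and $k+1$ edges. $\alpha$ denotes the independence number (maximum size of a vertex set containing no edge). A hypergraph is $c$-sparse if every vertex subset $S$ spans (i.e. contains) at most $c|S|^2$ edges. -}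

module Defs where

open import Data.Nat using (ℕ; zero; suc; _+_; _*_; _≤_)
open import Data.Fin using (Fin)
open import Data.Vec using (Vec; lookup)
open import Data.List using (List; []; _∷_; map; length; allFin)
open import Data.List.Membership.Propositional using (_∈_)
open import Data.List.Relation.Unary.Any using (Any)
open import Data.List.Relation.Unary.All using (All)
open import Data.List.Relation.Unary.AllPairs using (AllPairs)
open import Data.List.Relation.Unary.Unique.Propositional using (Unique)
open import Data.List.Relation.Binary.Subset.Propositional using (_⊆_)
open import Data.Product using (Σ; _×_; _,_; ∃)
open import Function.Bundles using (_⇔_)
open import Relation.Binary.PropositionalEquality using (_≡_)
open import Relation.Nullary using (¬_)

-- Finite sets represented as lists with set semantics.

SameSet : {A : Set} → List A → List A → Set
SameSet xs ys = ∀ z → (z ∈ xs) ⇔ (z ∈ ys)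

-- A hypergraph on vertex labels ℕ is given by its list of edges (each edge a
-- list of vertex labels).  `Cluster k E a b` says that E is (the edge list of)
-- a member of 𝒟_k whose vertex set is {0,…,2k-1}, and a, b are its two
-- disjoint edges.

data Cluster : ℕ → List (List ℕ) → List ℕ → List ℕ → Set where
  base : Cluster 2 ((0 ∷ 1 ∷ []) ∷ (1 ∷ 2 ∷ []) ∷ (2 ∷ 3 ∷ []) ∷ [])
                   (0 ∷ 1 ∷ []) (2 ∷ 3 ∷ [])
  -- the two disjoint edges are unordered
  swap : ∀ {k E a b} → Cluster k E a b → Cluster k E b a
  -- new vertices x = 2k, y = 2k+1: enlarge every edge by x, add a ∪ {y}.
  -- The two disjoint edges of the result are a ∪ {y} and b ∪ {x}.
  step : ∀ {k E a b} → Cluster k E a b →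
         Cluster (suc k) ((suc (k + k) ∷ a) ∷ map ((k + k) ∷_) E)
                         (suc (k + k) ∷ a) ((k + k) ∷ b)

-- The hypergraph J_k.
-- X_i is identified with Fin n (tagged by i), so X_1 × ⋯ × X_k = Vec (Fin n) k
-- and the vertex set of the k-partite hypergraph is Fin k × Fin n.

Tuple : ℕ → ℕ → Set
Tuple k n = Vec (Fin n) k

tupleEdge : ∀ {k n} → Tuple k n → List (Fin k × Fin n)
tupleEdge {k} t = map (λ i → (i , lookup t i)) (allFin k)

VertexOf : List (List ℕ) → ℕ → Set
VertexOf E v = Any (v ∈_) E

-- The k-partite hypergraph with edge set A (a set of tuples) is isomorphic to
-- the hypergraph E: there is a map φ from the vertices of E, injective on
-- them, such that the images of the edges of E are exactly the edges of A.
-- (E has no isolated vertices, so this is a bijection between the vertex sets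
-- spanned by the edges, mapping edges onto edges.)
IsoTo : ∀ {k n} → List (List ℕ) → List (Tuple k n) → Set
IsoTo {k} {n} E A = Σ (ℕ → Fin k × Fin n) λ φ →
    (∀ u v → VertexOf E u → VertexOf E v → φ u ≡ φ v → u ≡ v)
  × All (λ e → Σ (Tuple k n) λ t → t ∈ A × SameSet (map φ e) (tupleEdge t)) E
  × All (λ t → Σ (List ℕ) λ e → e ∈ E × SameSet (map φ e) (tupleEdge t)) A

JEdge : ∀ k n → List (List ℕ) → List (Tuple k n) → Set
JEdge k n E A = Unique A × IsoTo E A

Independent : {V : Set} → (List V → Set) → List V → Set
Independent Edge I = Unique I × (∀ A → Edge A → ¬ (A ⊆ I))

IndepNumberAtMost : {V : Set} → (List V → Set) → ℕ → Set
IndepNumberAtMost Edge m = ∀ I → Independent Edge I → length I ≤ m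

Sparse : {V : Set} → (List V → Set) → ℕ → Set
Sparse Edge c = ∀ (S : List _) → Unique S →
  ∀ (F : List (List _)) → All Edge F → All (_⊆ S) F →
  AllPairs (λ A B → ¬ SameSet A B) F →
  length F ≤ c * (length S * length S)

module Submission where

-- * The vertex count is the mixed-radix bijection Vec (Fin n) k ↔ Fin (n^k).
-- * Sparseness is a counting-by-encoding argument.  The two disjoint edges a, b of D_k
--   cover all its vertices, so every tuple of an edge A of J_k is a coordinatewise mix of
--   the tuples t_a, t_b of a and b.  Hence A is determined by t_a, t_b ∈ S and one mixing
--   pattern in Bool^k for each of the other k - 1 edges: S spans at most
--   |S|² (2^k)^(k-1) ≤ 2^(2k²-2k-1) |S|² edges.
-- * The independence bound follows the inductive construction of 𝒟_k.  An edge of J_k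
--   lifts to an edge of J_{k+1} for the stepped cluster, which yields the recurrence
--   α(J_{k+1}) ≤ n α(J_k) + n^k ≤ (k+1) n^k.  The base D₂ is, up to relabelling, the
--   step of the 1-cluster D₁ (two disjoint single-vertex edges), for which α(J₁) ≤ 1.

open import Defs
open import Data.Bool using (Bool; true; false; if_then_else_)
open import Data.Empty using (⊥-elim)
open import Data.Fin as Fin using (Fin; combine; remQuot)
open import Data.Fin.Properties using (remQuot-combine; combine-remQuot) renaming (_≟_ to _≟ᶠ_)
open import Data.List as List
  using (List; []; _∷_; map; length; allFin; _++_; cartesianProduct; cartesianProductWith; concatMap)
open import Data.List.Properties
  using (length-map; length-++; length-tabulate; length-removeAt′; map-∘; map-tabulate; map-cong-local)
open import Data.List.Membership.Propositional using (_∈_; _─_; find; lose)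
open import Data.List.Membership.Propositional.Properties
open import Data.List.Relation.Unary.Any using (Any; here; there; any?)
import Data.List.Relation.Unary.Any.Properties as Any
open import Data.List.Relation.Unary.All as All using (All; []; _∷_)
open import Data.List.Relation.Unary.AllPairs using (AllPairs; []; _∷_)
open import Data.List.Relation.Unary.Unique.Propositional using (Unique)
import Data.List.Relation.Unary.All.Properties as All
import Data.List.Relation.Unary.Unique.Propositional.Properties as Unique
open import Data.List.Relation.Binary.Subset.Propositional using (_⊆_)
open import Data.Nat using (ℕ; zero; suc; _+_; _*_; _∸_; _^_; _≤_; _<_; _<?_; z≤n; s≤s)
open import Data.Nat.Properties
open import Data.Product using (Σ; _×_; _,_; proj₁; proj₂)
open import Data.Sum using (_⊎_; inj₁; inj₂)
open import Data.Sum.Properties using (inj₁-injective; inj₂-injective)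
open import Data.Vec as Vec using (Vec; []; _∷_; lookup)
open import Data.Vec.Properties
  using (≡-dec; ∷-injective; ∷-injectiveˡ; ∷-injectiveʳ; tabulate∘lookup; tabulate-cong)
open import Function using (_∘_; id)
open import Function.Bundles using (_↔_; mk↔ₛ′; mk⇔; Equivalence)
import Function.Properties.Equivalence as ⇔
open import Relation.Binary.PropositionalEquality
open import Relation.Binary.Definitions using (DecidableEquality)
open import Relation.Nullary using (¬_; Dec; yes; no; does)
open import Relation.Nullary.Decidable using (from-yes; _×-dec_; ¬?)

pigeonhole : ∀ {A : Set} {xs ys : List A} → Unique xs → xs ⊆ ys → length xs ≤ length ys
pigeonhole {xs = []} _ _ = z≤n
pigeonhole {xs = x ∷ xs} {ys} (x∉xs ∷ uxs) xs⊆ys =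
  ≤-trans (s≤s (pigeonhole uxs xs⊆ys─x)) (≤-reflexive (sym (length-removeAt′ ys _)))
  where
  x∈ys : x ∈ ys
  x∈ys = xs⊆ys (here refl)
  ∈-─ : ∀ {zs z} (p : x ∈ zs) → z ∈ zs → x ≢ z → z ∈ zs ─ p
  ∈-─ (here refl) (here refl) x≢z = ⊥-elim (x≢z refl)
  ∈-─ (here _) (there q) _ = q
  ∈-─ (there p) (here eq) _ = here eq
  ∈-─ (there p) (there q) x≢z = there (∈-─ p q x≢z)
  xs⊆ys─x : xs ⊆ ys ─ x∈ys
  xs⊆ys─x z∈xs = ∈-─ x∈ys (xs⊆ys (there z∈xs)) (All.lookup x∉xs z∈xs)

encoding-bound : ∀ {X C : Set} {P : X → Set} {_#_ : X → X → Set} {xs : List X}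
  (code : ∀ {x} → P x → C) (codes : List C) →
  (∀ {x} (p : P x) → code p ∈ codes) →
  (∀ {x y} (p : P x) (q : P y) → code p ≡ code q → ¬ (x # y)) →
  All P xs → AllPairs _#_ xs → length xs ≤ length codes
encoding-bound {C = C} {P} {_#_} code codes code∈codes separating ps apart =
  ≤-trans (≤-reflexive (sym (length-encode ps)))
          (pigeonhole (unique-encode ps apart) (encode⊆codes ps))
  where
  encode : ∀ {ys} → All P ys → List C
  encode [] = []
  encode (p ∷ ps) = code p ∷ encode ps
  length-encode : ∀ {ys} (ps : All P ys) → length (encode ps) ≡ length ys
  length-encode [] = refl
  length-encode (_ ∷ ps) = cong suc (length-encode ps)
  encode⊆codes : ∀ {ys} (ps : All P ys) → encode ps ⊆ codes
  encode⊆codes (p ∷ _) (here refl) = code∈codes p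
  encode⊆codes (_ ∷ ps) (there c∈) = encode⊆codes ps c∈
  fresh : ∀ {y ys} (p : P y) (ps : All P ys) → All (y #_) ys → All (code p ≢_) (encode ps)
  fresh p [] [] = []
  fresh p (q ∷ ps) (y#z ∷ y#zs) = (λ eq → separating p q eq y#z) ∷ fresh p ps y#zs
  unique-encode : ∀ {ys} (ps : All P ys) → AllPairs _#_ ys → Unique (encode ps)
  unique-encode [] [] = []
  unique-encode (p ∷ ps) (y#ys ∷ apart) = fresh p ps y#ys ∷ unique-encode ps apart

length-concatMap-≤ : ∀ {A B : Set} (f : A → List B) {m} (xs : List A) →
  (∀ x → length (f x) ≤ m) → length (concatMap f xs) ≤ length xs * m
length-concatMap-≤ f [] _ = z≤n
length-concatMap-≤ f (x ∷ xs) bounded =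
  ≤-trans (≤-reflexive (length-++ (f x))) (+-mono-≤ (bounded x) (length-concatMap-≤ f xs bounded))

module _ {A : Set} where

  sameSet-refl : {xs : List A} → SameSet xs xs
  sameSet-refl _ = ⇔.refl

  sameSet-sym : {xs ys : List A} → SameSet xs ys → SameSet ys xs
  sameSet-sym xs≈ys z = ⇔.sym (xs≈ys z)

  sameSet-trans : {xs ys zs : List A} → SameSet xs ys → SameSet ys zs → SameSet xs zs
  sameSet-trans xs≈ys ys≈zs z = ⇔.trans (xs≈ys z) (ys≈zs z)

  sameSet-∷ : ∀ {x : A} {xs ys} → SameSet xs ys → SameSet (x ∷ xs) (x ∷ ys)
  sameSet-∷ xs≈ys z =
    mk⇔ (extend (Equivalence.to (xs≈ys z))) (extend (Equivalence.from (xs≈ys z)))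
    where
    extend : ∀ {x us vs} → (z ∈ us → z ∈ vs) → z ∈ x ∷ us → z ∈ x ∷ vs
    extend _ (here z≡x) = here z≡x
    extend f (there z∈us) = there (f z∈us)

  sameSet-swap : ∀ {x y : A} → SameSet (x ∷ y ∷ []) (y ∷ x ∷ [])
  sameSet-swap z = mk⇔ exchange exchange
    where
    exchange : ∀ {x y} → z ∈ x ∷ y ∷ [] → z ∈ y ∷ x ∷ []
    exchange (here z≡x) = there (here z≡x)
    exchange (there (here z≡y)) = here z≡y

sameSet-map : ∀ {A B : Set} (f : A → B) {xs ys} → SameSet xs ys → SameSet (map f xs) (map f ys)
sameSet-map f xs≈ys z =
  mk⇔ (transport (Equivalence.to ∘ xs≈ys)) (transport (Equivalence.from ∘ xs≈ys))
  where
  transport : ∀ {us vs} → (∀ x → x ∈ us → x ∈ vs) → z ∈ map f us → z ∈ map f vs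
  transport us⊆vs z∈fus with ∈-map⁻ f z∈fus
  ... | x , x∈us , refl = ∈-map⁺ f (us⊆vs x x∈us)

vectors : ∀ {A : Set} → List A → (r : ℕ) → List (Vec A r)
vectors L zero = [] ∷ []
vectors L (suc r) = cartesianProductWith _∷_ L (vectors L r)

length-cartesianProductWith : ∀ {A B C : Set} (f : A → B → C) xs ys →
  length (cartesianProductWith f xs ys) ≡ length xs * length ys
length-cartesianProductWith f [] ys = refl
length-cartesianProductWith f (x ∷ xs) ys = begin
  length (map (f x) ys ++ cartesianProductWith f xs ys)
    ≡⟨ length-++ (map (f x) ys) ⟩
  length (map (f x) ys) + length (cartesianProductWith f xs ys)
    ≡⟨ cong₂ _+_ (length-map (f x) ys) (length-cartesianProductWith f xs ys) ⟩
  length ys + length xs * length ys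
    ∎
  where open ≡-Reasoning

length-vectors : ∀ {A : Set} (L : List A) r → length (vectors L r) ≡ length L ^ r
length-vectors L zero = refl
length-vectors L (suc r) =
  trans (length-cartesianProductWith _∷_ L (vectors L r)) (cong (length L *_) (length-vectors L r))

∈-vectors : ∀ {A : Set} (L : List A) {r} (v : Vec A r) → (∀ i → lookup v i ∈ L) → v ∈ vectors L r
∈-vectors L [] _ = here refl
∈-vectors L (x ∷ v) entries∈L =
  ∈-cartesianProductWith⁺ _∷_ (entries∈L Fin.zero) (∈-vectors L v (entries∈L ∘ Fin.suc))

unique-vectors : ∀ {A : Set} {L : List A} → Unique L → ∀ r → Unique (vectors L r)
unique-vectors uL zero = [] ∷ []
unique-vectors uL (suc r) = Unique.cartesianProductWith⁺ _∷_ ∷-injective uL (unique-vectors uL r)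

tuples↔Fin : ∀ k n → Tuple k n ↔ Fin (n ^ k)
tuples↔Fin k n = mk↔ₛ′ (toFin k) (fromFin k) (toFin-fromFin k) (fromFin-toFin k)
  where
  toFin : ∀ k → Tuple k n → Fin (n ^ k)
  toFin zero [] = Fin.zero
  toFin (suc k) (c ∷ t) = combine c (toFin k t)
  fromFin : ∀ k → Fin (n ^ k) → Tuple k n
  fromFin zero _ = []
  fromFin (suc k) i = proj₁ (remQuot {n} (n ^ k) i) ∷ fromFin k (proj₂ (remQuot {n} (n ^ k) i))
  toFin-fromFin : ∀ k i → toFin k (fromFin k i) ≡ i
  toFin-fromFin zero Fin.zero = refl
  toFin-fromFin (suc k) i rewrite toFin-fromFin k (proj₂ (remQuot {n} (n ^ k) i)) =
    combine-remQuot {n} (n ^ k) i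
  fromFin-toFin : ∀ k t → fromFin k (toFin k t) ≡ t
  fromFin-toFin zero [] = refl
  fromFin-toFin (suc k) (c ∷ t) =
    trans (cong (λ (c , j) → c ∷ fromFin k j) (remQuot-combine {n} {n ^ k} c (toFin k t)))
          (cong (c ∷_) (fromFin-toFin k t))

vec-ext : ∀ {A : Set} {m} {u v : Vec A m} → (∀ i → lookup u i ≡ lookup v i) → u ≡ v
vec-ext {u = u} {v} u≗v = begin
  u                       ≡⟨ tabulate∘lookup u ⟨
  Vec.tabulate (lookup u) ≡⟨ tabulate-cong u≗v ⟩
  Vec.tabulate (lookup v) ≡⟨ tabulate∘lookup v ⟩
  v                       ∎
  where open ≡-Reasoning

module _ {A : Set} where

  mix : ∀ {m} → Vec A m → Vec A m → Vec Bool m → Vec A m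
  mix [] [] [] = []
  mix (x ∷ u) (y ∷ v) (b ∷ β) = (if b then x else y) ∷ mix u v β

  agreement : DecidableEquality A → ∀ {m} → Vec A m → Vec A m → Vec Bool m
  agreement _≟_ [] [] = []
  agreement _≟_ (x ∷ t) (y ∷ u) = does (x ≟ y) ∷ agreement _≟_ t u

  mix-agreement : (_≟_ : DecidableEquality A) → ∀ {m} (t u v : Vec A m) →
    (∀ i → lookup t i ≡ lookup u i ⊎ lookup t i ≡ lookup v i) →
    mix u v (agreement _≟_ t u) ≡ t
  mix-agreement _≟_ [] [] [] _ = refl
  mix-agreement _≟_ (x ∷ t) (y ∷ u) (z ∷ v) entryFrom with x ≟ y | entryFrom Fin.zero
  ... | yes refl | _ = cong (x ∷_) (mix-agreement _≟_ t u v (entryFrom ∘ Fin.suc))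
  ... | no x≢y | inj₁ x≡y = ⊥-elim (x≢y x≡y)
  ... | no _ | inj₂ refl = cong (x ∷_) (mix-agreement _≟_ t u v (entryFrom ∘ Fin.suc))

module _ {k n : ℕ} where

  ∈-tupleEdge⁻ : ∀ {t : Tuple k n} {i x} → (i , x) ∈ tupleEdge t → x ≡ lookup t i
  ∈-tupleEdge⁻ p with ∈-map⁻ _ p
  ... | _ , _ , refl = refl

  ∈-tupleEdge⁺ : ∀ (t : Tuple k n) i → (i , lookup t i) ∈ tupleEdge t
  ∈-tupleEdge⁺ t i = ∈-map⁺ _ (∈-allFin i)

  tupleEdge-injective : ∀ {t u : Tuple k n} → SameSet (tupleEdge t) (tupleEdge u) → t ≡ u
  tupleEdge-injective {t} {u} t≈u =
    vec-ext λ i → ∈-tupleEdge⁻ {t = u} (Equivalence.to (t≈u _) (∈-tupleEdge⁺ t i))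

shift : ∀ {k n} → Fin k × Fin n → Fin (suc k) × Fin n
shift (i , x) = (Fin.suc i , x)

shift-injective : ∀ {k n} {p q : Fin k × Fin n} → shift p ≡ shift q → p ≡ q
shift-injective {p = i , _} {q = .i , _} refl = refl

tupleEdge-∷ : ∀ {k n} (c : Fin n) (t : Tuple k n) →
  tupleEdge (c ∷ t) ≡ (Fin.zero , c) ∷ map shift (tupleEdge t)
tupleEdge-∷ {k} c t = cong ((Fin.zero , c) ∷_) (begin
  map (λ i → (i , lookup (c ∷ t) i)) (List.tabulate Fin.suc) ≡⟨ map-tabulate Fin.suc _ ⟩
  List.tabulate (λ i → (Fin.suc i , lookup t i))           ≡⟨ map-tabulate id _ ⟨
  map (shift ∘ (λ i → (i , lookup t i))) (allFin k)       ≡⟨ map-∘ (allFin k) ⟩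
  map shift (map (λ i → (i , lookup t i)) (allFin k))     ∎)
  where open ≡-Reasoning

record ClusterShape (k : ℕ) (E : List (List ℕ)) (a b : List ℕ) : Set where
  field
    a∈E : a ∈ E
    b∈E : b ∈ E
    covered : ∀ {e v} → e ∈ E → v ∈ e → v ∈ a ⊎ v ∈ b
    others : List (List ℕ)
    others-length : suc (length others) ≡ k
    others⊆E : others ⊆ E
    edge-kind : ∀ {e} → e ∈ E → e ≡ a ⊎ e ≡ b ⊎ e ∈ others
    bounded : ∀ {e v} → e ∈ E → v ∈ e → v < k + k

stepEdges : ℕ → List (List ℕ) → List ℕ → List (List ℕ)
stepEdges k E a = (suc (k + k) ∷ a) ∷ map ((k + k) ∷_) E

D₂ : List (List ℕ)
D₂ = (0 ∷ 1 ∷ []) ∷ (1 ∷ 2 ∷ []) ∷ (2 ∷ 3 ∷ []) ∷ []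

clusterShape : ∀ {k E a b} → Cluster k E a b → ClusterShape k E a b
clusterShape base = record
  { a∈E = here refl ; b∈E = there (there (here refl)) ; covered = covered
  ; others = (1 ∷ 2 ∷ []) ∷ [] ; others-length = refl
  ; others⊆E = λ { (here refl) → there (here refl) } ; edge-kind = edge-kind ; bounded = bounded }
  where
  covered : ∀ {e v} → e ∈ D₂ → v ∈ e → v ∈ 0 ∷ 1 ∷ [] ⊎ v ∈ 2 ∷ 3 ∷ []
  covered (here refl) v∈e = inj₁ v∈e
  covered (there (here refl)) (here refl) = inj₁ (there (here refl))
  covered (there (here refl)) (there (here refl)) = inj₂ (here refl)
  covered (there (there (here refl))) v∈e = inj₂ v∈e
  edge-kind : ∀ {e} → e ∈ D₂ →
    e ≡ 0 ∷ 1 ∷ [] ⊎ e ≡ 2 ∷ 3 ∷ [] ⊎ e ∈ (1 ∷ 2 ∷ []) ∷ []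
  edge-kind (here refl) = inj₁ refl
  edge-kind (there (here refl)) = inj₂ (inj₂ (here refl))
  edge-kind (there (there (here refl))) = inj₂ (inj₁ refl)
  bounded : ∀ {e v} → e ∈ D₂ → v ∈ e → v < 4
  bounded e∈D₂ = All.lookup (All.lookup (from-yes (All.all? (All.all? (_<? 4)) D₂)) e∈D₂)
clusterShape (swap c) = record
  { a∈E = b∈E ; b∈E = a∈E ; covered = λ e∈E v∈e → Data.Sum.swap (covered e∈E v∈e)
  ; others = others ; others-length = others-length ; others⊆E = others⊆E
  ; edge-kind = λ e∈E → reorder (edge-kind e∈E) ; bounded = bounded }
  where
  open ClusterShape (clusterShape c)
  reorder : ∀ {A B C : Set} → A ⊎ B ⊎ C → B ⊎ A ⊎ C
  reorder (inj₁ p) = inj₂ (inj₁ p)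
  reorder (inj₂ (inj₁ q)) = inj₁ q
  reorder (inj₂ (inj₂ r)) = inj₂ (inj₂ r)
clusterShape (step {k} {E} {a} {b} c) = record
  { a∈E = here refl ; b∈E = there (∈-map⁺ _ b∈E) ; covered = covered⁺
  ; others = (x ∷ a) ∷ map (x ∷_) others
  ; others-length = cong suc (trans (cong suc (length-map _ others)) others-length)
  ; others⊆E = others⊆E⁺ ; edge-kind = edge-kind⁺ ; bounded = bounded⁺ }
  where
  open ClusterShape (clusterShape c)
  x y : ℕ
  x = k + k
  y = suc (k + k)
  covered⁺ : ∀ {e v} → e ∈ stepEdges k E a → v ∈ e → v ∈ y ∷ a ⊎ v ∈ x ∷ b
  covered⁺ (here refl) v∈e = inj₁ v∈e
  covered⁺ (there p) v∈e with ∈-map⁻ (x ∷_) p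
  covered⁺ (there p) (here v≡x) | _ , _ , refl = inj₂ (here v≡x)
  covered⁺ (there p) (there v∈e) | _ , e∈E , refl with covered e∈E v∈e
  ... | inj₁ v∈a = inj₁ (there v∈a)
  ... | inj₂ v∈b = inj₂ (there v∈b)
  edge-kind⁺ : ∀ {e} → e ∈ stepEdges k E a →
    e ≡ y ∷ a ⊎ e ≡ x ∷ b ⊎ e ∈ (x ∷ a) ∷ map (x ∷_) others
  edge-kind⁺ (here refl) = inj₁ refl
  edge-kind⁺ (there p) with ∈-map⁻ (x ∷_) p
  ... | _ , e∈E , refl with edge-kind e∈E
  ... | inj₁ refl = inj₂ (inj₂ (here refl))
  ... | inj₂ (inj₁ refl) = inj₂ (inj₁ refl)
  ... | inj₂ (inj₂ e∈others) = inj₂ (inj₂ (there (∈-map⁺ (x ∷_) e∈others)))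
  others⊆E⁺ : (x ∷ a) ∷ map (x ∷_) others ⊆ stepEdges k E a
  others⊆E⁺ (here refl) = there (∈-map⁺ (x ∷_) a∈E)
  others⊆E⁺ (there p) with ∈-map⁻ (x ∷_) p
  ... | _ , e∈others , refl = there (∈-map⁺ (x ∷_) (others⊆E e∈others))
  x<2k+2 : x < suc k + suc k
  x<2k+2 = s≤s (+-monoʳ-≤ k (n≤1+n k))
  old<2k+2 : ∀ {v} → v < x → v < suc k + suc k
  old<2k+2 v<x = <-trans v<x x<2k+2
  bounded⁺ : ∀ {e v} → e ∈ stepEdges k E a → v ∈ e → v < suc k + suc k
  bounded⁺ (here refl) (here refl) = s≤s (≤-reflexive (sym (+-suc k k)))
  bounded⁺ (here refl) (there v∈a) = old<2k+2 (bounded a∈E v∈a)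
  bounded⁺ (there p) v∈e with ∈-map⁻ (x ∷_) p
  bounded⁺ (there p) (here refl) | _ , _ , refl = x<2k+2
  bounded⁺ (there p) (there v∈e) | _ , e∈E , refl = old<2k+2 (bounded e∈E v∈e)

module EdgeOfJ {k n : ℕ} {E : List (List ℕ)} {A : List (Tuple k n)} (j : JEdge k n E A) where

  φ : ℕ → Fin k × Fin n
  φ = proj₁ (proj₂ j)

  φ-injective : ∀ u v → VertexOf E u → VertexOf E v → φ u ≡ φ v → u ≡ v
  φ-injective = proj₁ (proj₂ (proj₂ j))

  private
    edgesToTuples : All (λ e → Σ (Tuple k n) λ t → t ∈ A × SameSet (map φ e) (tupleEdge t)) E
    edgesToTuples = proj₁ (proj₂ (proj₂ (proj₂ j)))
    tuplesToEdges : All (λ t → Σ (List ℕ) λ e → e ∈ E × SameSet (map φ e) (tupleEdge t)) A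
    tuplesToEdges = proj₂ (proj₂ (proj₂ (proj₂ j)))

  tupleOf : ∀ {e} → e ∈ E → Tuple k n
  tupleOf p = proj₁ (All.lookup edgesToTuples p)

  tupleOf-∈ : ∀ {e} (p : e ∈ E) → tupleOf p ∈ A
  tupleOf-∈ p = proj₁ (proj₂ (All.lookup edgesToTuples p))

  tupleOf-edge : ∀ {e} (p : e ∈ E) → SameSet (map φ e) (tupleEdge (tupleOf p))
  tupleOf-edge p = proj₂ (proj₂ (All.lookup edgesToTuples p))

  tupleOf-unique : ∀ {e t} (p : e ∈ E) → SameSet (map φ e) (tupleEdge t) → t ≡ tupleOf p
  tupleOf-unique p e≈t = tupleEdge-injective (sameSet-trans (sameSet-sym e≈t) (tupleOf-edge p))

  label-entry : ∀ {e v i x} (p : e ∈ E) → v ∈ e → φ v ≡ (i , x) → x ≡ lookup (tupleOf p) i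
  label-entry p v∈e φv≡ix =
    ∈-tupleEdge⁻ {t = tupleOf p}
      (subst (_∈ tupleEdge (tupleOf p)) φv≡ix (Equivalence.to (tupleOf-edge p _) (∈-map⁺ φ v∈e)))

  edgeOf : ∀ {t} → t ∈ A → List ℕ
  edgeOf q = proj₁ (All.lookup tuplesToEdges q)

  edgeOf-∈ : ∀ {t} (q : t ∈ A) → edgeOf q ∈ E
  edgeOf-∈ q = proj₁ (proj₂ (All.lookup tuplesToEdges q))

  edgeOf-edge : ∀ {t} (q : t ∈ A) → SameSet (map φ (edgeOf q)) (tupleEdge t)
  edgeOf-edge q = proj₂ (proj₂ (All.lookup tuplesToEdges q))

bools : List Bool
bools = true ∷ false ∷ []

∈-bools : ∀ β → β ∈ bools
∈-bools true = here refl
∈-bools false = there (here refl)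

-- Every vertex of the cluster lies in a or in b, so every
-- tuple of an edge A of J_k is a mix of the tuples t_a, t_b of a and b: A is determined
-- by t_a, t_b and one mixing pattern in Bool^k for each of the k - 1 other edges.
module Encoding {k n : ℕ} {E : List (List ℕ)} {a b : List ℕ} (shape : ClusterShape k E a b) where
  open ClusterShape shape

  Code : Set
  Code = Tuple k n × Tuple k n × Vec (Vec Bool k) (length others)

  decode : Code → List (Tuple k n)
  decode (ta , tb , patterns) = ta ∷ tb ∷ Vec.toList (Vec.map (mix ta tb) patterns)

  module _ {A : List (Tuple k n)} (j : JEdge k n E A) where
    open EdgeOfJ j

    ta tb : Tuple k n
    ta = tupleOf a∈E
    tb = tupleOf b∈E

    entry-from-a-or-b : ∀ {e} (p : e ∈ E) i →
      lookup (tupleOf p) i ≡ lookup ta i ⊎ lookup (tupleOf p) i ≡ lookup tb i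
    entry-from-a-or-b p i
      with ∈-map⁻ φ (Equivalence.from (tupleOf-edge p _) (∈-tupleEdge⁺ (tupleOf p) i))
    ... | v , v∈e , entry≡φv with covered p v∈e
    ... | inj₁ v∈a = inj₁ (label-entry a∈E v∈a (sym entry≡φv))
    ... | inj₂ v∈b = inj₂ (label-entry b∈E v∈b (sym entry≡φv))

    tuplesOf : (es : List (List ℕ)) → es ⊆ E → Vec (Tuple k n) (length es)
    tuplesOf [] _ = []
    tuplesOf (e ∷ es) es⊆E = tupleOf (es⊆E (here refl)) ∷ tuplesOf es (es⊆E ∘ there)

    ∈-tuplesOf⁺ : ∀ {es e} (es⊆E : es ⊆ E) (q : e ∈ es) →
      tupleOf (es⊆E q) ∈ Vec.toList (tuplesOf es es⊆E)
    ∈-tuplesOf⁺ es⊆E (here refl) = here refl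
    ∈-tuplesOf⁺ es⊆E (there q) = there (∈-tuplesOf⁺ (es⊆E ∘ there) q)

    ∈-tuplesOf⁻ : ∀ {es t} (es⊆E : es ⊆ E) → t ∈ Vec.toList (tuplesOf es es⊆E) → t ∈ A
    ∈-tuplesOf⁻ {_ ∷ _} es⊆E (here refl) = tupleOf-∈ (es⊆E (here refl))
    ∈-tuplesOf⁻ {_ ∷ _} es⊆E (there t∈) = ∈-tuplesOf⁻ (es⊆E ∘ there) t∈

    patternsOf : ∀ {es} → es ⊆ E → Vec (Vec Bool k) (length es)
    patternsOf es⊆E = Vec.map (λ t → agreement _≟ᶠ_ t ta) (tuplesOf _ es⊆E)

    mix-patternsOf : ∀ {es} (es⊆E : es ⊆ E) →
      Vec.map (mix ta tb) (patternsOf es⊆E) ≡ tuplesOf es es⊆E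
    mix-patternsOf {[]} _ = refl
    mix-patternsOf {_ ∷ _} es⊆E =
      cong₂ _∷_ (mix-agreement _≟ᶠ_ _ ta tb (entry-from-a-or-b (es⊆E (here refl))))
                (mix-patternsOf (es⊆E ∘ there))

    code : Code
    code = ta , tb , patternsOf others⊆E

    decode-code : SameSet (decode code) A
    decode-code t rewrite mix-patternsOf others⊆E = mk⇔ sound complete
      where
      sound : t ∈ ta ∷ tb ∷ Vec.toList (tuplesOf others others⊆E) → t ∈ A
      sound (here refl) = tupleOf-∈ a∈E
      sound (there (here refl)) = tupleOf-∈ b∈E
      sound (there (there t∈)) = ∈-tuplesOf⁻ others⊆E t∈
      complete : t ∈ A → t ∈ ta ∷ tb ∷ Vec.toList (tuplesOf others others⊆E)
      complete t∈A with edge-kind (edgeOf-∈ t∈A) | edgeOf-edge t∈A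
      ... | inj₁ refl | e≈t = here (tupleOf-unique a∈E e≈t)
      ... | inj₂ (inj₁ refl) | e≈t = there (here (tupleOf-unique b∈E e≈t))
      ... | inj₂ (inj₂ e∈others) | e≈t =
        there (there (subst (_∈ _) (sym (tupleOf-unique (others⊆E e∈others) e≈t))
                                   (∈-tuplesOf⁺ others⊆E e∈others)))

  codes : List (Tuple k n) → List Code
  codes S = cartesianProduct S (cartesianProduct S (vectors (vectors bools k) (length others)))

  length-codes : ∀ S → length (codes S) ≡ length S * (length S * (2 ^ k) ^ length others)
  length-codes S = begin
    length (codes S)
      ≡⟨ length-cartesianProductWith _,_ S _ ⟩
    s * length (cartesianProduct S patterns)
      ≡⟨ cong (s *_) (length-cartesianProductWith _,_ S _) ⟩
    s * (s * length patterns)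
      ≡⟨ cong (λ m → s * (s * m)) (length-vectors (vectors bools k) (length others)) ⟩
    s * (s * length (vectors bools k) ^ length others)
      ≡⟨ cong (λ m → s * (s * m ^ length others)) (length-vectors bools k) ⟩
    s * (s * (2 ^ k) ^ length others)
      ∎
    where
    open ≡-Reasoning
    s : ℕ
    s = length S
    patterns : List (Vec (Vec Bool k) (length others))
    patterns = vectors (vectors bools k) (length others)

  code∈codes : ∀ {S A} (j : JEdge k n E A) → A ⊆ S → code j ∈ codes S
  code∈codes j A⊆S =
    ∈-cartesianProduct⁺ (A⊆S (tupleOf-∈ a∈E))
      (∈-cartesianProduct⁺ (A⊆S (tupleOf-∈ b∈E)) patterns∈)
    where
    open EdgeOfJ j
    patterns : Vec (Vec Bool k) (length others)
    patterns = patternsOf j others⊆E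
    patterns∈ : patterns ∈ vectors (vectors bools k) (length others)
    patterns∈ = ∈-vectors _ patterns λ i →
      ∈-vectors bools (lookup patterns i) (∈-bools ∘ lookup (lookup patterns i))

  sparse : Sparse (JEdge k n E) ((2 ^ k) ^ length others)
  sparse S _ F Fedges F⊆S apart = begin
    length F                                         ≤⟨ encoding-bound (λ (j , _) → code j) (codes S)
                                                          (λ (j , A⊆S) → code∈codes j A⊆S) same-code
                                                          (All.zip (Fedges , F⊆S)) apart ⟩
    length (codes S)                                 ≡⟨ length-codes S ⟩
    length S * (length S * (2 ^ k) ^ length others)  ≡⟨ *-assoc (length S) _ _ ⟨
    length S * length S * (2 ^ k) ^ length others    ≡⟨ *-comm (length S * length S) _ ⟩
    (2 ^ k) ^ length others * (length S * length S)  ∎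
    where
    open ≤-Reasoning
    same-code : ∀ {A B} (p : JEdge k n E A × A ⊆ S) (q : JEdge k n E B × B ⊆ S) →
      code (proj₁ p) ≡ code (proj₁ q) → ¬ ¬ SameSet A B
    same-code {B = B} (j , _) (j' , _) codes≡ A≉B = A≉B (sameSet-trans
      (sameSet-sym (decode-code j)) (subst (λ c → SameSet (decode c) B) (sym codes≡) (decode-code j')))

-- Let E⁺ be the stepped cluster (new vertices
-- x = 2k, y = 2k+1).  If A is an edge of J_k for E and c' ≢ c, then
-- (c' ∷ t_a) ∷ map (c ∷_) A is an edge of J_{k+1} for E⁺: label x by (0 , c),
-- y by (0 , c') and the old vertices as before, shifted by one part.
module Lifting {k n : ℕ} {E : List (List ℕ)} {a : List ℕ}
               (a∈E : a ∈ E) (bounded : ∀ {e v} → e ∈ E → v ∈ e → v < k + k)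
               {A : List (Tuple k n)} (j : JEdge k n E A)
               {c c' : Fin n} (c'≢c : c' ≢ c) where
  open EdgeOfJ j

  x y : ℕ
  x = k + k
  y = suc (k + k)

  φ⁺ : ℕ → Fin (suc k) × Fin n
  φ⁺ v with v <? x | v ≟ x
  ... | yes _ | _ = shift (φ v)
  ... | no _ | yes _ = (Fin.zero , c)
  ... | no _ | no _ = (Fin.zero , c')

  φ⁺-old : ∀ {v} → v < x → φ⁺ v ≡ shift (φ v)
  φ⁺-old {v} v<x with v <? x
  ... | yes _ = refl
  ... | no v≮x = ⊥-elim (v≮x v<x)

  φ⁺-x : φ⁺ x ≡ (Fin.zero , c)
  φ⁺-x with x <? x | x ≟ x
  ... | yes x<x | _ = ⊥-elim (<-irrefl refl x<x)
  ... | no _ | yes _ = refl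
  ... | no _ | no x≢x = ⊥-elim (x≢x refl)

  φ⁺-y : φ⁺ y ≡ (Fin.zero , c')
  φ⁺-y with y <? x | y ≟ x
  ... | yes y<x | _ = ⊥-elim (<-asym y<x (n<1+n x))
  ... | no _ | yes y≡x = ⊥-elim (1+n≢n y≡x)
  ... | no _ | no _ = refl

  data StepVertex : ℕ → Set where
    new-y : StepVertex y
    new-x : StepVertex x
    old : ∀ {u} → VertexOf E u → u < x → StepVertex u

  classify : ∀ {u} → VertexOf (stepEdges k E a) u → StepVertex u
  classify (here (here refl)) = new-y
  classify (here (there u∈a)) = old (lose a∈E u∈a) (bounded a∈E u∈a)
  classify (there u∈x∷E) with find (Any.map⁻ u∈x∷E)
  ... | _ , _ , here refl = new-x
  ... | _ , e∈E , there u∈e = old (lose e∈E u∈e) (bounded e∈E u∈e)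

  y≢x : φ⁺ y ≢ φ⁺ x
  y≢x eq = c'≢c (cong proj₂ (trans (sym φ⁺-y) (trans eq φ⁺-x)))

  new≢old : ∀ {w d v} → φ⁺ w ≡ (Fin.zero , d) → v < x → φ⁺ w ≢ φ⁺ v
  new≢old {w} φ⁺w≡ v<x eq with trans (sym φ⁺w≡) (trans eq (φ⁺-old v<x))
  ... | ()

  φ⁺-injective : ∀ u v → VertexOf (stepEdges k E a) u → VertexOf (stepEdges k E a) v →
    φ⁺ u ≡ φ⁺ v → u ≡ v
  φ⁺-injective u v u∈ v∈ eq with classify u∈ | classify v∈
  ... | new-y | new-y = refl
  ... | new-x | new-x = refl
  ... | new-y | new-x = ⊥-elim (y≢x eq)
  ... | new-x | new-y = ⊥-elim (y≢x (sym eq))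
  ... | new-y | old _ v<x = ⊥-elim (new≢old φ⁺-y v<x eq)
  ... | new-x | old _ v<x = ⊥-elim (new≢old φ⁺-x v<x eq)
  ... | old _ u<x | new-y = ⊥-elim (new≢old φ⁺-y u<x (sym eq))
  ... | old _ u<x | new-x = ⊥-elim (new≢old φ⁺-x u<x (sym eq))
  ... | old u∈E u<x | old v∈E v<x =
    φ-injective u v u∈E v∈E (shift-injective (trans (sym (φ⁺-old u<x)) (trans eq (φ⁺-old v<x))))

  map-φ⁺-old : ∀ {e} → e ∈ E → map φ⁺ e ≡ map shift (map φ e)
  map-φ⁺-old e∈E = trans (map-cong-local (All.tabulate (φ⁺-old ∘ bounded e∈E))) (map-∘ _)

  lift-sameSet : ∀ {e w d} {t : Tuple k n} → e ∈ E → φ⁺ w ≡ (Fin.zero , d) →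
    SameSet (map φ e) (tupleEdge t) → SameSet (map φ⁺ (w ∷ e)) (tupleEdge (d ∷ t))
  lift-sameSet {d = d} {t} e∈E φ⁺w≡ e≈t rewrite φ⁺w≡ | map-φ⁺-old e∈E | tupleEdge-∷ d t =
    sameSet-∷ (sameSet-map shift e≈t)

  ta : Tuple k n
  ta = tupleOf a∈E

  lift-edge : JEdge (suc k) n (stepEdges k E a) ((c' ∷ ta) ∷ map (c ∷_) A)
  lift-edge =
    (All.map⁺ (All.tabulate λ _ eq → c'≢c (∷-injectiveˡ eq)) ∷ Unique.map⁺ ∷-injectiveʳ (proj₁ j))
    , φ⁺ , φ⁺-injective
    , (c' ∷ ta , here refl , a-edge)
      ∷ All.map⁺ (All.tabulate λ e∈E →
          c ∷ tupleOf e∈E , there (∈-map⁺ _ (tupleOf-∈ e∈E))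
          , lift-sameSet e∈E φ⁺-x (tupleOf-edge e∈E))
    , (y ∷ a , here refl , a-edge)
      ∷ All.map⁺ (All.tabulate λ t∈A →
          x ∷ edgeOf t∈A , there (∈-map⁺ _ (edgeOf-∈ t∈A))
          , lift-sameSet (edgeOf-∈ t∈A) φ⁺-x (edgeOf-edge t∈A))
    where
    a-edge : SameSet (map φ⁺ (y ∷ a)) (tupleEdge (c' ∷ ta))
    a-edge = lift-sameSet a∈E φ⁺-y (tupleOf-edge a∈E)

α-recurrence : ∀ k n → n * (k * n ^ (k ∸ 1)) + n ^ k ≡ suc k * n ^ k
α-recurrence zero n = cong (_+ 1) (*-zeroʳ n)
α-recurrence (suc k) n = begin
  n * (suc k * n ^ k) + n ^ suc k ≡⟨ cong (_+ n ^ suc k) (*-assoc n (suc k) (n ^ k)) ⟨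
  n * suc k * n ^ k + n ^ suc k   ≡⟨ cong (λ m → m * n ^ k + n ^ suc k) (*-comm n (suc k)) ⟩
  suc k * n * n ^ k + n ^ suc k   ≡⟨ cong (_+ n ^ suc k) (*-assoc (suc k) n (n ^ k)) ⟩
  suc k * n ^ suc k + n ^ suc k   ≡⟨ +-comm (suc k * n ^ suc k) _ ⟩
  suc (suc k) * n ^ suc k         ∎
  where open ≡-Reasoning

-- Call c ∷ s ∈ I partnered if some c' ∷ s ∈ I has c' ≢ c.  For fixed c
-- the partnered tails s form an independent set of J_k (an edge inside would lift into I),
-- so there are at most n · k n^(k-1) partnered elements; the unpartnered ones have distinct
-- tails, so there are at most n^k of them.
module IndependenceStep {k n : ℕ} {E : List (List ℕ)} {a : List ℕ}
                        (a∈E : a ∈ E) (bounded : ∀ {e v} → e ∈ E → v ∈ e → v < k + k)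
                        (α-bound : IndepNumberAtMost (JEdge k n E) (k * n ^ (k ∸ 1))) where

  tails : List (Tuple k n)
  tails = vectors (allFin n) k

  ∈-tails : ∀ s → s ∈ tails
  ∈-tails s = ∈-vectors (allFin n) s (∈-allFin ∘ lookup s)

  length-tails : length tails ≡ n ^ k
  length-tails = trans (length-vectors (allFin n) k) (cong (_^ k) (length-tabulate {n = n} id))

  module _ {I : List (Tuple (suc k) n)}
           (I-indep : Independent (JEdge (suc k) n (stepEdges k E a)) I) where

    Partnered : Fin n → Tuple k n → Set
    Partnered c s = (c ∷ s) ∈ I × Any (λ c' → c' ≢ c × (c' ∷ s) ∈ I) (allFin n)

    partnered? : ∀ c s → Dec (Partnered c s)
    partnered? c s = ∈I? (c ∷ s) ×-dec any? (λ c' → ¬? (c' ≟ᶠ c) ×-dec ∈I? (c' ∷ s)) (allFin n)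
      where
      ∈I? : ∀ t → Dec (t ∈ I)
      ∈I? t = any? (≡-dec _≟ᶠ_ t) I

    partneredTails : Fin n → List (Tuple k n)
    partneredTails c = List.filter (partnered? c) tails

    partneredTails-independent : ∀ c → Independent (JEdge k n E) (partneredTails c)
    partneredTails-independent c =
      Unique.filter⁺ (partnered? c) (unique-vectors (Unique.allFin⁺ n) k) , no-edge
      where
      partnered : ∀ {s} → s ∈ partneredTails c → Partnered c s
      partnered s∈ = proj₂ (∈-filter⁻ (partnered? c) {xs = tails} s∈)
      -- t_a ∈ A is partnered at c by some c' ≢ c, and the lifted edge lies in I
      no-edge : ∀ A → JEdge k n E A → ¬ (A ⊆ partneredTails c)
      no-edge A j A⊆ with find (proj₂ (partnered (A⊆ (EdgeOfJ.tupleOf-∈ j a∈E))))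
      ... | c' , _ , c'≢c , c'∷ta∈I = proj₂ I-indep _ (Lifting.lift-edge a∈E bounded j c'≢c) lifted⊆I
        where
        lifted⊆I : (c' ∷ EdgeOfJ.tupleOf j a∈E) ∷ map (c ∷_) A ⊆ I
        lifted⊆I (here refl) = c'∷ta∈I
        lifted⊆I (there t∈) with ∈-map⁻ (c ∷_) t∈
        ... | _ , s∈A , refl = proj₁ (partnered (A⊆ s∈A))

    Code : Set
    Code = (Fin n × Tuple k n) ⊎ Tuple k n

    code : Tuple (suc k) n → Code
    code (c ∷ s) with partnered? c s
    ... | yes _ = inj₁ (c , s)
    ... | no _ = inj₂ s

    inj₁≢inj₂ : ∀ {p : Fin n × Tuple k n} {q : Tuple k n} → inj₁ p ≢ inj₂ q
    inj₁≢inj₂ ()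

    code-injective : ∀ {u v} → u ∈ I → v ∈ I → code u ≡ code v → u ≡ v
    code-injective {c ∷ s} {d ∷ t} u∈I v∈I eq with partnered? c s | partnered? d t
    ... | yes _ | yes _ = cong (λ (c , s) → c ∷ s) (inj₁-injective eq)
    ... | yes _ | no _ = ⊥-elim (inj₁≢inj₂ eq)
    ... | no _ | yes _ = ⊥-elim (inj₁≢inj₂ (sym eq))
    ... | no unpartnered | no _ with inj₂-injective eq
    ...   | refl with c ≟ᶠ d
    ...     | yes refl = refl
    ...     | no c≢d = ⊥-elim (unpartnered (u∈I , lose (∈-allFin d) (c≢d ∘ sym , v∈I)))

    partneredCodes : Fin n → List Code
    partneredCodes c = map (inj₁ ∘ (c ,_)) (partneredTails c)

    codes : List Code
    codes = concatMap partneredCodes (allFin n) ++ map inj₂ tails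

    code∈codes : ∀ {u} → u ∈ I → code u ∈ codes
    code∈codes {c ∷ s} _ with partnered? c s
    ... | yes p = ∈-++⁺ˡ (∈-concatMap⁺ partneredCodes
                   (lose (∈-allFin c) (∈-map⁺ _ (∈-filter⁺ (partnered? c) (∈-tails s) p))))
    ... | no _ = ∈-++⁺ʳ _ (∈-map⁺ inj₂ (∈-tails s))

    length-codes : length codes ≤ suc k * n ^ k
    length-codes = begin
      length codes
        ≡⟨ length-++ (concatMap partneredCodes (allFin n)) ⟩
      length (concatMap partneredCodes (allFin n)) + length (map inj₂ tails)
        ≤⟨ +-mono-≤ partnered-bound (≤-reflexive (trans (length-map inj₂ tails) length-tails)) ⟩
      n * (k * n ^ (k ∸ 1)) + n ^ k
        ≡⟨ α-recurrence k n ⟩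
      suc k * n ^ k
        ∎
      where
      open ≤-Reasoning
      partnered-bound : length (concatMap partneredCodes (allFin n)) ≤ n * (k * n ^ (k ∸ 1))
      partnered-bound = ≤-trans
        (length-concatMap-≤ partneredCodes (allFin n) λ c →
          ≤-trans (≤-reflexive (length-map _ (partneredTails c))) (α-bound _ (partneredTails-independent c)))
        (≤-reflexive (cong (_* (k * n ^ (k ∸ 1))) (length-tabulate {n = n} id)))

    length-I : length I ≤ suc k * n ^ k
    length-I = ≤-trans
      (encoding-bound (λ {u} _ → code u) codes code∈codes
        (λ u∈I v∈I eq u≢v → u≢v (code-injective u∈I v∈I eq)) (All.tabulate id) (proj₁ I-indep))
      length-codes

  α-step : IndepNumberAtMost (JEdge (suc k) n (stepEdges k E a)) (suc k * n ^ k)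
  α-step _ I-indep = length-I I-indep

independence-mono : ∀ {V : Set} {Edge Edge' : List V → Set} {m} →
  (∀ A → Edge A → Edge' A) → IndepNumberAtMost Edge m → IndepNumberAtMost Edge' m
independence-mono Edge⊆Edge' α I (unique , no-edge') =
  α I (unique , λ A edge → no-edge' A (Edge⊆Edge' A edge))

relabel : ∀ {k n} {E E' : List (List ℕ)} (ψ ψ⁻ : ℕ → ℕ) →
  (∀ {u} → VertexOf E' u → ψ⁻ (ψ u) ≡ u) →
  (∀ {e'} → e' ∈ E' → Σ (List ℕ) λ e → e ∈ E × SameSet (map ψ e') e) →
  (∀ {e} → e ∈ E → Σ (List ℕ) λ e' → e' ∈ E' × SameSet (map ψ e') e) →
  ∀ {A} → JEdge k n E A → JEdge k n E' A
relabel {E = E} {E'} ψ ψ⁻ left-inverse forward backward {A} j =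
  proj₁ j , φ ∘ ψ , φψ-injective
  , All.tabulate (λ e'∈E' → let (e , e∈E , e'≈e) = forward e'∈E' in
      tupleOf e∈E , tupleOf-∈ e∈E , sameSet-trans (image e'≈e) (tupleOf-edge e∈E))
  , All.tabulate (λ t∈A → let (e' , e'∈E' , e'≈e) = backward (edgeOf-∈ t∈A) in
      e' , e'∈E' , sameSet-trans (image e'≈e) (edgeOf-edge t∈A))
  where
  open EdgeOfJ j
  image : ∀ {e' e} → SameSet (map ψ e') e → SameSet (map (φ ∘ ψ) e') (map φ e)
  image {e'} e'≈e rewrite map-∘ {g = φ} {f = ψ} e' = sameSet-map φ e'≈e
  vertex : ∀ {u} → VertexOf E' u → VertexOf E (ψ u)
  vertex u∈E' with find u∈E'
  ... | _ , e'∈E' , u∈e' with forward e'∈E'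
  ... | _ , e∈E , e'≈e = lose e∈E (Equivalence.to (e'≈e _) (∈-map⁺ ψ u∈e'))
  φψ-injective : ∀ u v → VertexOf E' u → VertexOf E' v → φ (ψ u) ≡ φ (ψ v) → u ≡ v
  φψ-injective u v u∈E' v∈E' eq = begin
    u          ≡⟨ left-inverse u∈E' ⟨
    ψ⁻ (ψ u)   ≡⟨ cong ψ⁻ (φ-injective _ _ (vertex u∈E') (vertex v∈E') eq) ⟩
    ψ⁻ (ψ v)   ≡⟨ left-inverse v∈E' ⟩
    v          ∎
    where open ≡-Reasoning

D₁ : List (List ℕ)
D₁ = (0 ∷ []) ∷ (1 ∷ []) ∷ []

-- α(J₁) ≤ 1 for D₁, since any two distinct 1-tuples form an edge of J₁.
α-D₁ : ∀ n → IndepNumberAtMost (JEdge 1 n D₁) (1 * n ^ (1 ∸ 1))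
α-D₁ n [] _ = z≤n
α-D₁ n (_ ∷ []) _ = s≤s z≤n
α-D₁ n ((x ∷ []) ∷ (y ∷ []) ∷ _) ((distinct ∷ _) , no-edge) = ⊥-elim (no-edge _ pair-edge pair⊆I)
  where
  x≢y : (x ∷ []) ≢ (y ∷ [])
  x≢y = All.head distinct
  φ : ℕ → Fin 1 × Fin n
  φ zero = (Fin.zero , x)
  φ (suc _) = (Fin.zero , y)
  φ0≢φ1 : φ 0 ≢ φ 1
  φ0≢φ1 eq = x≢y (cong (_∷ []) (cong proj₂ eq))
  φ-injective : ∀ u v → VertexOf D₁ u → VertexOf D₁ v → φ u ≡ φ v → u ≡ v
  φ-injective _ _ (here (here refl)) (here (here refl)) _ = refl
  φ-injective _ _ (there (here (here refl))) (there (here (here refl))) _ = refl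
  φ-injective _ _ (here (here refl)) (there (here (here refl))) eq = ⊥-elim (φ0≢φ1 eq)
  φ-injective _ _ (there (here (here refl))) (here (here refl)) eq = ⊥-elim (φ0≢φ1 (sym eq))
  pair-edge : JEdge 1 n D₁ ((x ∷ []) ∷ (y ∷ []) ∷ [])
  pair-edge = ((x≢y ∷ []) ∷ [] ∷ []) , φ , φ-injective
    , ((x ∷ []) , here refl , sameSet-refl) ∷ ((y ∷ []) , there (here refl) , sameSet-refl) ∷ []
    , ((0 ∷ []) , here refl , sameSet-refl) ∷ ((1 ∷ []) , there (here refl) , sameSet-refl) ∷ []
  pair⊆I : (x ∷ []) ∷ (y ∷ []) ∷ [] ⊆ (x ∷ []) ∷ (y ∷ []) ∷ _
  pair⊆I (here refl) = here refl
  pair⊆I (there (here refl)) = there (here refl)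

-- D₂, the path 0-1-2-3, is the step of D₁ (the path 3-0-2-1) relabelled by ψ.
α-D₂ : ∀ n → IndepNumberAtMost (JEdge 2 n D₂) (2 * n ^ (2 ∸ 1))
α-D₂ n = independence-mono (λ _ → relabel ψ ψ⁻ left-inverse forward backward)
  (IndependenceStep.α-step (here refl) bounded-D₁ (α-D₁ n))
  where
  ψ ψ⁻ : ℕ → ℕ
  ψ 0 = 3
  ψ 1 = 0
  ψ 2 = 2
  ψ _ = 1
  ψ⁻ 3 = 0
  ψ⁻ 0 = 1
  ψ⁻ 2 = 2
  ψ⁻ _ = 3
  bounded-D₁ : ∀ {e v} → e ∈ D₁ → v ∈ e → v < 1 + 1
  bounded-D₁ (here refl) (here refl) = s≤s z≤n
  bounded-D₁ (there (here refl)) (here refl) = s≤s (s≤s z≤n)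
  below-4 : ∀ {u} → u < 4 → ψ⁻ (ψ u) ≡ u
  below-4 {0} _ = refl
  below-4 {1} _ = refl
  below-4 {2} _ = refl
  below-4 {3} _ = refl
  below-4 {suc (suc (suc (suc _)))} (s≤s (s≤s (s≤s (s≤s ()))))
  left-inverse : ∀ {u} → VertexOf D₂ u → ψ⁻ (ψ u) ≡ u
  left-inverse u∈D₂ with find u∈D₂
  ... | _ , e∈D₂ , u∈e = below-4 (ClusterShape.bounded (clusterShape base) e∈D₂ u∈e)
  forward : ∀ {e'} → e' ∈ D₂ →
    Σ (List ℕ) λ e → e ∈ stepEdges 1 D₁ (0 ∷ []) × SameSet (map ψ e') e
  forward (here refl) = _ , here refl , sameSet-refl
  forward (there (here refl)) = _ , there (here refl) , sameSet-swap
  forward (there (there (here refl))) = _ , there (there (here refl)) , sameSet-refl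
  backward : ∀ {e} → e ∈ stepEdges 1 D₁ (0 ∷ []) →
    Σ (List ℕ) λ e' → e' ∈ D₂ × SameSet (map ψ e') e
  backward (here refl) = _ , here refl , sameSet-refl
  backward (there (here refl)) = _ , there (here refl) , sameSet-swap
  backward (there (there (here refl))) = _ , there (there (here refl)) , sameSet-refl

α-bound : ∀ {k} n {E a b} → Cluster k E a b → IndepNumberAtMost (JEdge k n E) (k * n ^ (k ∸ 1))
α-bound n base = α-D₂ n
α-bound n (swap c) = α-bound n c
α-bound n (step c) = IndependenceStep.α-step a∈E bounded (α-bound n c)
  where open ClusterShape (clusterShape c)

sparse-mono : ∀ {V : Set} {Edge : List V → Set} {c d} → c ≤ d → Sparse Edge c → Sparse Edge d
sparse-mono c≤d sparse S unique F edges F⊆S apart =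
  ≤-trans (sparse S unique F edges F⊆S apart) (*-monoˡ-≤ _ c≤d)

-- (2^k)^(k-1) = 2^(k(k-1)) ≤ 2^(2k² - 2k - 1), as k(k-1) ≥ 1 for k ≥ 2.
pattern-count-bound : ∀ k r → suc r ≡ k → 2 ≤ k → (2 ^ k) ^ r ≤ 2 ^ (2 * (k * k) ∸ 2 * k ∸ 1)
pattern-count-bound .(suc (suc q)) (suc q) refl (s≤s (s≤s z≤n)) = begin
  (2 ^ k) ^ r                  ≡⟨ ^-*-assoc 2 k r ⟩
  2 ^ (k * r)                  ≤⟨ ^-monoʳ-≤ 2 exponent ⟩
  2 ^ (2 * (k * k) ∸ 2 * k ∸ 1) ∎
  where
  open ≤-Reasoning
  r k : ℕ
  r = suc q
  k = suc r
  twice : 2 * (k * k) ∸ 2 * k ≡ k * r + k * r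
  twice = begin-equality
    2 * (k * k) ∸ 2 * k               ≡⟨ cong (λ m → 2 * m ∸ 2 * k) (*-suc k r) ⟩
    2 * (k + k * r) ∸ 2 * k           ≡⟨ cong (_∸ 2 * k) (*-distribˡ-+ 2 k (k * r)) ⟩
    2 * k + 2 * (k * r) ∸ 2 * k       ≡⟨ m+n∸m≡n (2 * k) (2 * (k * r)) ⟩
    2 * (k * r)                       ≡⟨ cong (k * r +_) (+-identityʳ (k * r)) ⟩
    k * r + k * r                     ∎
  exponent : k * r ≤ 2 * (k * k) ∸ 2 * k ∸ 1
  exponent = begin
    k * r                   ≤⟨ m≤m+n (k * r) (k * r ∸ 1) ⟩
    k * r + (k * r ∸ 1)     ≡⟨ +-∸-assoc (k * r) {k * r} (s≤s z≤n) ⟨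
    k * r + k * r ∸ 1       ≡⟨ cong (_∸ 1) twice ⟨
    2 * (k * k) ∸ 2 * k ∸ 1 ∎

mainTheorem5 : (k n : ℕ) → 2 ≤ k → 1 ≤ n →
    ∀ {E : List (List ℕ)} {a b : List ℕ} → Cluster k E a b →
    (Tuple k n ↔ Fin (n ^ k))
    × IndepNumberAtMost (JEdge k n E) (k * n ^ (k ∸ 1))
    × Sparse (JEdge k n E) (2 ^ (2 * (k * k) ∸ 2 * k ∸ 1))
mainTheorem5 k n k≥2 _ cluster =
    tuples↔Fin k n
  , α-bound n cluster
  , sparse-mono (pattern-count-bound k (length others) others-length k≥2)
                (Encoding.sparse (clusterShape cluster))
  where open ClusterShape (clusterShape cluster)
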